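{- For every intuitionistic modal logic $\mathbf{L}$ with $\mathbf{L}_{\mathbf{dc}}\subseteq\mathbf{L}\subseteq\mathbf{L}_{\mathbf{fbdc}}$, the Disjunction Property fails for $\mathbf{L}$: there exist formulas $A,B$ with $A\vee B\in\mathbf{L}$, $A\notin\mathbf{L}$ and $B\notin\mathbf{L}$.
   Context: Formulas are built from a countably infinite set of atoms by $A::=p\mid (A\rightarrow A)\mid\top\mid\bot\mid(A\vee A)\mid(A\wedge A)\mid\square A\mid\lozenge A$; $\neg A$ abbreviates $A\rightarrow\bot$. An intuitionistic modal logic is a set of formulas closed under uniform substitution, containing the axioms of intuitionistic propositional logic, closed under modus ponens, containing (A1) $\square(p\rightarrow q)\rightarrow(\square p\rightarrow\square q)$, (A2) $\square(p\vee q)\rightarrow((\lozenge p\rightarrow\square q)\rightarrow\square q)$, (A3) $\lozenge(p\vee q)\rightarrow\lozenge p\vee\lozenge q$, (A4) $\neg\lozenge\bot$, and closed under (R1) from $p$ infer $\square p$, (R2) from $p\rightarrow q$ infer $\lozenge p\rightarrow\lozenge q$, (R3) from $\lozenge p\rightarrow q\vee\square(p\rightarrow r)$ infer $\lozenge p\rightarrow q\vee\lozenge r$. $\mathbf{L}_{\min}$ is the least one; $\mathbf{L}\oplus\Sigma$ the least one containing $\mathbf{L}$ and $\Sigma$. $\mathbf{L}_{\mathbf{dc}}=\mathbf{L}_{\min}\oplus(\square(p\vee q)\rightarrow\lozenge p\vee\square q)$ and $\mathbf{L}_{\mathbf{fbdc}}=\mathbf{L}_{\min}\oplus\{\lozenge(p\rightarrow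 q)\rightarrow(\square p\rightarrow\lozenge q),\ (\lozenge p\rightarrow\square q)\rightarrow\square(p\rightarrow q),\ \square(p\vee q)\rightarrow\lozenge p\vee\square q\}$. -}

module Defs where

open import Data.Nat using (ℕ)
open import Data.Empty using (⊥)
open import Relation.Binary.PropositionalEquality using (_≡_)
open import Data.Sum using (_⊎_)

infixr 5 _⇒_
infixr 6 _∨_
infixr 7 _∧_

data Fm : Set where
  var  : ℕ → Fm
  _⇒_  : Fm → Fm → Fm
  top  : Fm
  bot  : Fm
  _∨_  : Fm → Fm → Fm
  _∧_  : Fm → Fm → Fm
  □    : Fm → Fm
  ◇    : Fm → Fm

¬f : Fm → Fm
¬f A = A ⇒ bot

sub : (ℕ → Fm) → Fm → Fm
sub σ (var n) = σ n
sub σ (A ⇒ B) = sub σ A ⇒ sub σ B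
sub σ top = top
sub σ bot = bot
sub σ (A ∨ B) = sub σ A ∨ sub σ B
sub σ (A ∧ B) = sub σ A ∧ sub σ B
sub σ (□ A) = □ (sub σ A)
sub σ (◇ A) = ◇ (sub σ A)

p q r : Fm
p = var 0
q = var 1
r = var 2

data IPCAx : Fm → Set where
  k   : ∀ A B → IPCAx (A ⇒ (B ⇒ A))
  s   : ∀ A B C → IPCAx ((A ⇒ (B ⇒ C)) ⇒ ((A ⇒ B) ⇒ (A ⇒ C)))
  ∧e₁ : ∀ A B → IPCAx ((A ∧ B) ⇒ A)
  ∧e₂ : ∀ A B → IPCAx ((A ∧ B) ⇒ B)
  ∧i  : ∀ A B → IPCAx (A ⇒ (B ⇒ (A ∧ B)))
  ∨i₁ : ∀ A B → IPCAx (A ⇒ (A ∨ B))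
  ∨i₂ : ∀ A B → IPCAx (B ⇒ (A ∨ B))
  ∨e  : ∀ A B C → IPCAx ((A ⇒ C) ⇒ ((B ⇒ C) ⇒ ((A ∨ B) ⇒ C)))
  efq : ∀ A → IPCAx (bot ⇒ A)
  ⊤i  : IPCAx top

A1 A2 A3 A4 : Fm
A1 = □ (p ⇒ q) ⇒ (□ p ⇒ □ q)
A2 = □ (p ∨ q) ⇒ ((◇ p ⇒ □ q) ⇒ □ q)
A3 = ◇ (p ∨ q) ⇒ (◇ p ∨ ◇ q)
A4 = ¬f (◇ bot)

record IsIML (L : Fm → Set) : Set where
  field
    closedSub : ∀ σ A → L A → L (sub σ A)
    ipc       : ∀ A → IPCAx A → L A
    mp        : ∀ A B → L (A ⇒ B) → L A → L B
    a1        : L A1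
    a2        : L A2
    a3        : L A3
    a4        : L A4
    r1        : ∀ A → L A → L (□ A)
    r2        : ∀ A B → L (A ⇒ B) → L (◇ A ⇒ ◇ B)
    r3        : ∀ A B C → L (◇ A ⇒ (B ∨ □ (A ⇒ C))) → L (◇ A ⇒ (B ∨ ◇ C))

-- L_min ⊕ Σ : the least intuitionistic modal logic containing Σ
data Thm (Σ : Fm → Set) : Fm → Set where
  ax        : ∀ {A} → Σ A → Thm Σ A
  closedSub : ∀ σ {A} → Thm Σ A → Thm Σ (sub σ A)
  ipc       : ∀ {A} → IPCAx A → Thm Σ A
  mp        : ∀ {A B} → Thm Σ (A ⇒ B) → Thm Σ A → Thm Σ B
  a1        : Thm Σ A1
  a2        : Thm Σ A2
  a3        : Thm Σ A3
  a4        : Thm Σ A4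
  r1        : ∀ {A} → Thm Σ A → Thm Σ (□ A)
  r2        : ∀ {A B} → Thm Σ (A ⇒ B) → Thm Σ (◇ A ⇒ ◇ B)
  r3        : ∀ {A B C} → Thm Σ (◇ A ⇒ (B ∨ □ (A ⇒ C))) → Thm Σ (◇ A ⇒ (B ∨ ◇ C))

DC FB1 FB2 : Fm
DC  = □ (p ∨ q) ⇒ (◇ p ∨ □ q)
FB1 = ◇ (p ⇒ q) ⇒ (□ p ⇒ ◇ q)
FB2 = (◇ p ⇒ □ q) ⇒ □ (p ⇒ q)

DcAx : Fm → Set
DcAx A = A ≡ DC

FbdcAx : Fm → Set
FbdcAx A = (A ≡ FB1 ⊎ A ≡ FB2) ⊎ A ≡ DC

Ldc Lfbdc : Fm → Set
Ldc   = Thm DcAx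
Lfbdc = Thm FbdcAx

-- Substituting ⊤ for p and ⊥ for q in dc, and necessitating ⊤ ∨ ⊥, puts ◇⊤ ∨ □⊥ into L_dc.
-- Neither disjunct lies in L_fbdc: the two one-world Kripke frames, where forcing is classical,
-- validate L_fbdc, and ◇⊤ fails at a world without successors while □⊥ fails at a reflexive one.
module Submission where

open import Defs
open import Data.Bool using (Bool; true; false; T; not)
  renaming (_∧_ to _∧ᵇ_; _∨_ to _∨ᵇ_)
open import Data.Bool.Properties using (T-∧)
open import Data.Nat using (ℕ)
open import Data.Product using (Σ; _×_; _,_; proj₁; proj₂)
open import Data.Sum using (inj₁; inj₂)
open import Function.Bundles using (Equivalence)
open import Relation.Nullary using (¬_)
open import Relation.Binary.PropositionalEquality using (_≡_; refl; sym; cong; cong₂; subst)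

all₁ : (Bool → Bool) → Bool
all₁ f = f true ∧ᵇ f false

all₂ : (Bool → Bool → Bool) → Bool
all₂ f = all₁ (λ x → all₁ (f x))

all₃ : (Bool → Bool → Bool → Bool) → Bool
all₃ f = all₁ (λ x → all₂ (f x))

T-all₁ : ∀ f → T (all₁ f) → ∀ x → T (f x)
T-all₁ f h true  = proj₁ (Equivalence.to T-∧ h)
T-all₁ f h false = proj₂ (Equivalence.to T-∧ h)

T-all₂ : ∀ f → T (all₂ f) → ∀ x y → T (f x y)
T-all₂ f h x = T-all₁ (f x) (T-all₁ (λ x → all₁ (f x)) h x)

T-all₃ : ∀ f → T (all₃ f) → ∀ x y z → T (f x y z)
T-all₃ f h x = T-all₂ (f x) (T-all₁ (λ x → all₂ (f x)) h x)

T-⇒ : ∀ a b → T (not a ∨ᵇ b) → T a → T b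
T-⇒ true b h _ = h

data OneWorldFrame : Set where
  dead-end reflexive : OneWorldFrame

box dia : OneWorldFrame → Bool → Bool
box dead-end  _ = true
box reflexive a = a
dia dead-end  _ = false
dia reflexive a = a

⟦_⟧ : Fm → OneWorldFrame → (ℕ → Bool) → Bool
⟦ var n ⟧ w v = v n
⟦ A ⇒ B ⟧ w v = not (⟦ A ⟧ w v) ∨ᵇ ⟦ B ⟧ w v
⟦ top   ⟧ w v = true
⟦ bot   ⟧ w v = false
⟦ A ∨ B ⟧ w v = ⟦ A ⟧ w v ∨ᵇ ⟦ B ⟧ w v
⟦ A ∧ B ⟧ w v = ⟦ A ⟧ w v ∧ᵇ ⟦ B ⟧ w v
⟦ □ A   ⟧ w v = box w (⟦ A ⟧ w v)
⟦ ◇ A   ⟧ w v = dia w (⟦ A ⟧ w v)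

Valid : OneWorldFrame → Fm → Set
Valid w A = ∀ v → T (⟦ A ⟧ w v)

⟦sub⟧ : ∀ σ A w v → ⟦ sub σ A ⟧ w v ≡ ⟦ A ⟧ w (λ n → ⟦ σ n ⟧ w v)
⟦sub⟧ σ (var n) w v = refl
⟦sub⟧ σ (A ⇒ B) w v = cong₂ (λ a b → not a ∨ᵇ b) (⟦sub⟧ σ A w v) (⟦sub⟧ σ B w v)
⟦sub⟧ σ top     w v = refl
⟦sub⟧ σ bot     w v = refl
⟦sub⟧ σ (A ∨ B) w v = cong₂ _∨ᵇ_ (⟦sub⟧ σ A w v) (⟦sub⟧ σ B w v)
⟦sub⟧ σ (A ∧ B) w v = cong₂ _∧ᵇ_ (⟦sub⟧ σ A w v) (⟦sub⟧ σ B w v)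
⟦sub⟧ σ (□ A)   w v = cong (box w) (⟦sub⟧ σ A w v)
⟦sub⟧ σ (◇ A)   w v = cong (dia w) (⟦sub⟧ σ A w v)

Valid-sub : ∀ w σ A → Valid w A → Valid w (sub σ A)
Valid-sub w σ A ⊨A v = subst T (sym (⟦sub⟧ σ A w v)) (⊨A _)

val₃ : Bool → Bool → Bool → ℕ → Bool
val₃ x y z 0 = x
val₃ x y z 1 = y
val₃ x y z 2 = z
val₃ x y z _ = false

-- For C in the atoms p, q, r, the value ⟦ C ⟧ w (val₃ ⟦ A ⟧ ⟦ B ⟧ ⟦ D ⟧) reduces to that of the
-- instance C[A, B, D / p, q, r]; so checking C's truth table validates all its instances.
truth-table : ∀ C → T (all₃ (λ x y z → ⟦ C ⟧ dead-end  (val₃ x y z)))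
                  → T (all₃ (λ x y z → ⟦ C ⟧ reflexive (val₃ x y z)))
                  → ∀ w x y z → T (⟦ C ⟧ w (val₃ x y z))
truth-table C ⊨dead-end ⊨reflexive dead-end  = T-all₃ _ ⊨dead-end
truth-table C ⊨dead-end ⊨reflexive reflexive = T-all₃ _ ⊨reflexive

IPCAx-valid : ∀ w {A} → IPCAx A → Valid w A
IPCAx-valid w (k A B)   v = truth-table (p ⇒ q ⇒ p) _ _ w (⟦ A ⟧ w v) (⟦ B ⟧ w v) false
IPCAx-valid w (s A B C) v =
  truth-table ((p ⇒ q ⇒ r) ⇒ (p ⇒ q) ⇒ p ⇒ r) _ _ w (⟦ A ⟧ w v) (⟦ B ⟧ w v) (⟦ C ⟧ w v)
IPCAx-valid w (∧e₁ A B) v = truth-table (p ∧ q ⇒ p) _ _ w (⟦ A ⟧ w v) (⟦ B ⟧ w v) false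
IPCAx-valid w (∧e₂ A B) v = truth-table (p ∧ q ⇒ q) _ _ w (⟦ A ⟧ w v) (⟦ B ⟧ w v) false
IPCAx-valid w (∧i A B)  v = truth-table (p ⇒ q ⇒ p ∧ q) _ _ w (⟦ A ⟧ w v) (⟦ B ⟧ w v) false
IPCAx-valid w (∨i₁ A B) v = truth-table (p ⇒ p ∨ q) _ _ w (⟦ A ⟧ w v) (⟦ B ⟧ w v) false
IPCAx-valid w (∨i₂ A B) v = truth-table (q ⇒ p ∨ q) _ _ w (⟦ A ⟧ w v) (⟦ B ⟧ w v) false
IPCAx-valid w (∨e A B C) v =
  truth-table ((p ⇒ r) ⇒ (q ⇒ r) ⇒ p ∨ q ⇒ r) _ _ w (⟦ A ⟧ w v) (⟦ B ⟧ w v) (⟦ C ⟧ w v)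
IPCAx-valid w (efq A)   v = _
IPCAx-valid w ⊤i        v = _

FbdcAx-valid : ∀ w {A} → FbdcAx A → Valid w A
FbdcAx-valid w (inj₁ (inj₁ refl)) v = truth-table FB1 _ _ w (v 0) (v 1) false
FbdcAx-valid w (inj₁ (inj₂ refl)) v = truth-table FB2 _ _ w (v 0) (v 1) false
FbdcAx-valid w (inj₂ refl)        v = truth-table DC _ _ w (v 0) (v 1) false

r3-reflexive : ∀ a b c → T (not a ∨ᵇ (b ∨ᵇ (not a ∨ᵇ c))) → T (not a ∨ᵇ (b ∨ᵇ c))
r3-reflexive true  b c h = h
r3-reflexive false b c h = _

Lfbdc-sound : ∀ w {A} → Lfbdc A → Valid w A
Lfbdc-sound w (ax fbdc)              = FbdcAx-valid w fbdc
Lfbdc-sound w (closedSub σ {A} ⊢A)   = Valid-sub w σ A (Lfbdc-sound w ⊢A)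
Lfbdc-sound w (ipc i)                = IPCAx-valid w i
Lfbdc-sound w (mp {A} {B} ⊢A⇒B ⊢A) v =
  T-⇒ (⟦ A ⟧ w v) (⟦ B ⟧ w v) (Lfbdc-sound w ⊢A⇒B v) (Lfbdc-sound w ⊢A v)
Lfbdc-sound w a1 v = truth-table A1 _ _ w (v 0) (v 1) false
Lfbdc-sound w a2 v = truth-table A2 _ _ w (v 0) (v 1) false
Lfbdc-sound w a3 v = truth-table A3 _ _ w (v 0) (v 1) false
Lfbdc-sound w a4 v = truth-table A4 _ _ w (v 0) (v 1) false
Lfbdc-sound dead-end  (r1 ⊢A)   v = _
Lfbdc-sound reflexive (r1 ⊢A)     = Lfbdc-sound reflexive ⊢A
Lfbdc-sound dead-end  (r2 ⊢A⇒B) v = _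
Lfbdc-sound reflexive (r2 ⊢A⇒B)   = Lfbdc-sound reflexive ⊢A⇒B
Lfbdc-sound dead-end  (r3 ⊢)     v = _
Lfbdc-sound reflexive (r3 {A} {B} {C} ⊢) v =
  r3-reflexive (⟦ A ⟧ reflexive v) (⟦ B ⟧ reflexive v) (⟦ C ⟧ reflexive v) (Lfbdc-sound reflexive ⊢ v)

◇⊤∉Lfbdc : ¬ Lfbdc (◇ top)
◇⊤∉Lfbdc ⊢◇⊤ = Lfbdc-sound dead-end ⊢◇⊤ (λ _ → false)

□⊥∉Lfbdc : ¬ Lfbdc (□ bot)
□⊥∉Lfbdc ⊢□⊥ = Lfbdc-sound reflexive ⊢□⊥ (λ _ → false)

◇⊤∨□⊥∈Ldc : Ldc (◇ top ∨ □ bot)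
◇⊤∨□⊥∈Ldc = mp (closedSub ⊤/p,⊥/q (ax refl)) (r1 (mp (ipc (∨i₁ top bot)) (ipc ⊤i)))
  where
  ⊤/p,⊥/q : ℕ → Fm
  ⊤/p,⊥/q 0 = top
  ⊤/p,⊥/q _ = bot

mainTheorem17 : (L : Fm → Set) → IsIML L → (∀ A → Ldc A → L A) → (∀ A → L A → Lfbdc A)
    → Σ Fm (λ A → Σ Fm (λ B → L (A ∨ B) × ¬ L A × ¬ L B))
mainTheorem17 L _ Ldc⊆L L⊆Lfbdc =
  ◇ top , □ bot ,
  Ldc⊆L _ ◇⊤∨□⊥∈Ldc ,
  (λ ⊢◇⊤ → ◇⊤∉Lfbdc (L⊆Lfbdc _ ⊢◇⊤)) ,
  (λ ⊢□⊥ → □⊥∉Lfbdc (L⊆Lfbdc _ ⊢□⊥))
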